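{- There is a set $A\subseteq\omega$ which is $0$-weakly stochastic but not $0$-Church stochastic.
   Context: For $A\subseteq\omega$, the density of $A$ at $n$ is $\rho_n(A)=|A\cap\{0,\dots,n-1\}|/n$, and $\rho(A)$ denotes $\lim_n\rho_n(A)$ when it exists ($\overline{\rho}$ is the $\limsup$). A skip sequence is an element $\sigma$ of $(\omega\times 2)^{<\omega}$ whose first coordinates are strictly increasing; $\sigma(k)_0$ is the first coordinate of the $k$-th entry, $\sigma(k)_1$ the second. Let $S$ be the set of skip sequences. A skip rule is a total function $f:S\to\omega$ with $f(\sigma)>\sigma(|\sigma|-1)_0$ for all $\sigma\in S$. Given $A$, the selected sequence $f(A)$ is defined recursively by $\chi_{f(A)}(0)=A(f(\emptyset))$ and $\chi_{f(A)}(n+1)=A(f(f(A)\upharpoonright n+1))$, where $f(A)\upharpoonright n+1$ is read as the skip sequence of the doors selected so far paired with their bits. $A$ is $\alpha$-weakly stochastic if $\rho(f(A))=\alpha$ for every computable skip rule $f$ (i.e. orderly, adaptive selection where every examined bit must be selected). $A$ is $\alpha$-Church stochastic if for every total computable selection strategy that scans the bits of $A$ in the original order and, using the previously scanned bits, computably decides whether to select the next bit (bits may be scanned without being selected), the selected subsequence, if infinite, has density $\alpha$. -}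

module Defs where

open import Level using (0ℓ)
open import Data.Nat using (ℕ; zero; suc; _+_; _*_; _≤_; _<_)
open import Data.Nat.DivMod using (_/_)
open import Data.Bool using (Bool; true; false; if_then_else_; _∧_)
open import Data.Fin using (Fin)
open import Data.Vec using (Vec; []; _∷_; lookup)
open import Data.List using (List; []; _∷_; _++_; [_])
open import Data.List.Relation.Unary.Linked using (Linked)
open import Data.Product using (Σ; ∃; _×_; _,_; proj₁)
open import Data.Maybe using (Maybe; just; nothing)
open import Relation.Nullary using (¬_)

data Code : ℕ → Set where
  zr   : Code 0
  sc   : Code 1
  pr   : ∀ {k} → Fin k → Code k
  comp : ∀ {k m} → Code m → Vec (Code k) m → Code k
  prec : ∀ {k} → Code k → Code (suc (suc k)) → Code (suc k)
  mu   : ∀ {k} → Code (suc k) → Code k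

data Eval : ∀ {k} → Code k → Vec ℕ k → ℕ → Set
data EvalAll : ∀ {k m} → Vec (Code k) m → Vec ℕ k → Vec ℕ m → Set

data Eval where
  ev-zr   : Eval zr [] 0
  ev-sc   : ∀ x → Eval sc (x ∷ []) (suc x)
  ev-pr   : ∀ {k} (i : Fin k) xs → Eval (pr i) xs (lookup xs i)
  ev-comp : ∀ {k m} {f : Code m} {gs : Vec (Code k) m} {xs ys z} →
            EvalAll gs xs ys → Eval f ys z → Eval (comp f gs) xs z
  ev-prec0 : ∀ {k} {g : Code k} {h} {xs z} →
             Eval g xs z → Eval (prec g h) (0 ∷ xs) z
  ev-precS : ∀ {k} {g : Code k} {h} {n xs y z} →
             Eval (prec g h) (n ∷ xs) y → Eval h (n ∷ y ∷ xs) z →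
             Eval (prec g h) (suc n ∷ xs) z
  ev-mu   : ∀ {k} {f : Code (suc k)} {xs n} →
            Eval f (n ∷ xs) 0 →
            (∀ i → i < n → Σ ℕ (λ m → Eval f (i ∷ xs) (suc m))) →
            Eval (mu f) xs n

data EvalAll where
  ea-[] : ∀ {k} {xs : Vec ℕ k} → EvalAll [] xs []
  ea-∷  : ∀ {k m} {g : Code k} {gs : Vec (Code k) m} {xs y ys} →
          Eval g xs y → EvalAll gs xs ys → EvalAll (g ∷ gs) xs (y ∷ ys)

Computable : (ℕ → ℕ) → Set
Computable f = Σ (Code 1) (λ c → ∀ n → Eval c (n ∷ []) (f n))

pair : ℕ → ℕ → ℕ
pair x y = ((x + y) * suc (x + y)) / 2 + y

bit : Bool → ℕ
bit true  = 1
bit false = 0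

encList : {A : Set} → (A → ℕ) → List A → ℕ
encList e []       = 0
encList e (x ∷ xs) = suc (pair (e x) (encList e xs))

-- skip sequences (as lists of (door, bit) pairs, entry 0 first)
SkipSeq : Set
SkipSeq = List (ℕ × Bool)

encSkip : SkipSeq → ℕ
encSkip = encList (λ p → pair (proj₁ p) (bit (Data.Product.proj₂ p)))

IsSkip : SkipSeq → Set
IsSkip = Linked (λ p q → proj₁ p < proj₁ q)

lastDoor : SkipSeq → Maybe ℕ
lastDoor []          = nothing
lastDoor (p ∷ [])    = just (proj₁ p)
lastDoor (p ∷ q ∷ σ) = lastDoor (q ∷ σ)

Above : Maybe ℕ → ℕ → Set
Above nothing  n = Data.Unit.⊤
  where import Data.Unit
Above (just m) n = m < n

-- f (defined on all lists; only its values on skip sequences matter)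
-- is a skip rule, computed by some code on skip sequences.
IsComputableSkipRule : (SkipSeq → ℕ) → Set
IsComputableSkipRule f =
  (∀ σ → IsSkip σ → Above (lastDoor σ) (f σ)) ×
  Σ (Code 1) (λ c → ∀ σ → IsSkip σ → Eval c (encSkip σ ∷ []) (f σ))

Set⊆ω : Set
Set⊆ω = ℕ → Bool

history : (SkipSeq → ℕ) → Set⊆ω → ℕ → SkipSeq
history f A zero    = []
history f A (suc n) = history f A n ++ [ (f (history f A n) , A (f (history f A n))) ]

selected : (SkipSeq → ℕ) → Set⊆ω → Set⊆ω
selected f A n = A (f (history f A n))

count : Set⊆ω → ℕ → ℕ
count A zero    = 0
count A (suc n) = count A n + bit (A n)

-- ρ(A) = 0 :  for every k, eventually ρ_n(A) ≤ 1/(k+1)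
Density0 : Set⊆ω → Set
Density0 A = ∀ k → Σ ℕ λ N → ∀ n → N ≤ n → count A n * suc k ≤ n

WeaklyStochastic0 : Set⊆ω → Set
WeaklyStochastic0 A = ∀ f → IsComputableSkipRule f → Density0 (selected f A)

prefix : Set⊆ω → ℕ → List Bool
prefix A zero    = []
prefix A (suc n) = prefix A n ++ [ A n ]

-- a total computable selection strategy: g (A ↾ n) decides whether bit n is selected
IsComputableStrategy : (List Bool → Bool) → Set
IsComputableStrategy g =
  Σ (Code 1) (λ c → ∀ w → Eval c (encList bit w ∷ []) (bit (g w)))

nSel : (List Bool → Bool) → Set⊆ω → ℕ → ℕ
nSel g A zero    = 0
nSel g A (suc m) = nSel g A m + bit (g (prefix A m))

nSelOnes : (List Bool → Bool) → Set⊆ω → ℕ → ℕ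
nSelOnes g A zero    = 0
nSelOnes g A (suc m) = nSelOnes g A m + bit (g (prefix A m) ∧ A m)

SelInfinite : (List Bool → Bool) → Set⊆ω → Set
SelInfinite g A = ∀ N → Σ ℕ λ n → N ≤ n × g (prefix A n) ≡ true
  where open import Relation.Binary.PropositionalEquality using (_≡_)

SelDensity0 : (List Bool → Bool) → Set⊆ω → Set
SelDensity0 g A = ∀ k → Σ ℕ λ N → ∀ m → N ≤ m → nSelOnes g A m * suc k ≤ nSel g A m

ChurchStochastic0 : Set⊆ω → Set
ChurchStochastic0 A =
  ∀ g → IsComputableStrategy g → SelInfinite g A → SelDensity0 g A

-- Under excluded middle every code can be run as a total function, so the computable skip rules
-- can be listed as rule 0, rule 1, …  The set A is built in stages: stage k appends a block of
-- two adjacent ones beyond every door that rules 0, …, k − 1 open among their first horizon k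
-- selections on the part of A built so far.  These doors never change later, so for j > e rule e
-- meets at most 2 j ones among its first 2 (j + 1)² selections, and its selected sequence has
-- density 0.  On the other hand the ones of A come in isolated adjacent pairs, so the Church
-- strategy that selects a bit whenever the previous bit is 1 meets, in every block, its second
-- one and the zero after it: its selected sequence has density 1/2.

module Submission where

open import Defs
open import Level using (0ℓ)
open import Axiom.ExcludedMiddle using (ExcludedMiddle)
open import Data.Bool using (Bool; true; false; _∧_; _∨_)
open import Data.Bool.Properties using (∨-identityʳ; ∨-zeroʳ; ¬-not)
open import Data.Empty using (⊥-elim)
open import Data.Fin using (zero; suc; toℕ)
open import Data.Fin.Properties using (toℕ-injective)
open import Data.List using (List; []; _∷_; _++_; [_]; length; last; applyUpTo)
open import Data.List.Extrema.Nat using (max; xs≤max)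
open import Data.List.Membership.Propositional.Properties using (∈-applyUpTo⁺)
open import Data.List.Relation.Unary.All as All using ()
open import Data.List.Relation.Unary.Linked using ([]; [-]; _∷_)
open import Data.Maybe using (just; fromMaybe)
open import Data.Nat
open import Data.Nat.DivMod using (m*n/n≡m)
open import Data.Nat.GeneralisedArithmetic using (fold; iterate; iterate-is-fold)
open import Data.Nat.Properties
open import Data.Nat.Tactic.RingSolver using (solve-∀)
open import Data.Product using (Σ; ∃; _×_; _,_; proj₁; proj₂)
open import Data.Sum using (inj₁; inj₂; [_,_]′)
open import Data.Vec using (Vec; []; _∷_)
open import Relation.Binary.PropositionalEquality hiding ([_])
open import Relation.Binary.Definitions using (tri<; tri≈; tri>)
open import Relation.Nullary using (¬_; Dec; yes; no)

triangle : ℕ → ℕ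
triangle zero    = zero
triangle (suc s) = suc s + triangle s

s*[1+s]≡triangle*2 : ∀ s → s * suc s ≡ triangle s * 2
s*[1+s]≡triangle*2 zero    = refl
s*[1+s]≡triangle*2 (suc s) = begin
  suc s * suc (suc s)          ≡⟨ expand s ⟩
  suc s * 2 + s * suc s        ≡⟨ cong (suc s * 2 +_) (s*[1+s]≡triangle*2 s) ⟩
  suc s * 2 + triangle s * 2   ≡⟨ *-distribʳ-+ 2 (suc s) (triangle s) ⟨
  triangle (suc s) * 2         ∎
  where
  open ≡-Reasoning
  expand : ∀ s → suc s * suc (suc s) ≡ suc s * 2 + s * suc s
  expand = solve-∀

pair≡triangle+ : ∀ x y → pair x y ≡ triangle (x + y) + y
pair≡triangle+ x y =
  cong (_+ y) (trans (cong (_/ 2) (s*[1+s]≡triangle*2 (x + y))) (m*n/n≡m (triangle (x + y)) 2))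

triangle-suc-≤ : ∀ {s s'} → s < s' → triangle (suc s) ≤ triangle s'
triangle-suc-≤ {s} {suc s'} (s≤s s≤s') with m≤n⇒m<n∨m≡n s≤s'
... | inj₁ s<s' = ≤-trans (triangle-suc-≤ s<s') (m≤n+m (triangle s') (suc s'))
... | inj₂ refl = ≤-refl

OnDiagonal : ℕ → ℕ → Set
OnDiagonal s p = triangle s ≤ p × p < triangle (suc s)

onDiagonal-unique : ∀ {s s' p} → OnDiagonal s p → OnDiagonal s' p → s ≡ s'
onDiagonal-unique {s} {s'} (lo , hi) (lo' , hi') with <-cmp s s'
... | tri< s<s' _ _ = ⊥-elim (<-irrefl refl (<-≤-trans hi (≤-trans (triangle-suc-≤ s<s') lo')))
... | tri≈ _ s≡s' _ = s≡s'
... | tri> _ _ s'<s = ⊥-elim (<-irrefl refl (<-≤-trans hi' (≤-trans (triangle-suc-≤ s'<s) lo)))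

pair-onDiagonal : ∀ x y → OnDiagonal (x + y) (pair x y)
pair-onDiagonal x y rewrite pair≡triangle+ x y =
  m≤m+n _ y , subst (_< triangle (suc (x + y))) (+-comm y (triangle (x + y)))
                    (+-monoˡ-< (triangle (x + y)) (s≤s (m≤n+m y x)))

diagonal : ℕ → ℕ
diagonal zero    = zero
diagonal (suc p) with triangle (suc (diagonal p)) ≤? suc p
... | yes _ = suc (diagonal p)
... | no  _ = diagonal p

diagonal-onDiagonal : ∀ p → OnDiagonal (diagonal p) p
diagonal-onDiagonal zero = z≤n , s≤s z≤n
diagonal-onDiagonal (suc p) with diagonal-onDiagonal p | triangle (suc (diagonal p)) ≤? suc p
... | _  , hi | yes reached =
  reached , subst (_< triangle (2 + diagonal p)) (≤-antisym reached hi) (m<n+m _ {2 + diagonal p} z<s)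
... | lo , _  | no  below   = m≤n⇒m≤1+n lo , ≰⇒> below

diagonal-pair : ∀ x y → diagonal (pair x y) ≡ x + y
diagonal-pair x y = onDiagonal-unique (diagonal-onDiagonal (pair x y)) (pair-onDiagonal x y)

unpair₂ : ℕ → ℕ
unpair₂ p = p ∸ triangle (diagonal p)

unpair₂-pair : ∀ x y → unpair₂ (pair x y) ≡ y
unpair₂-pair x y = begin
  pair x y ∸ triangle (diagonal (pair x y))  ≡⟨ cong (λ s → pair x y ∸ triangle s) (diagonal-pair x y) ⟩
  pair x y ∸ triangle (x + y)                ≡⟨ cong (_∸ triangle (x + y)) (pair≡triangle+ x y) ⟩
  triangle (x + y) + y ∸ triangle (x + y)    ≡⟨ m+n∸m≡n (triangle (x + y)) y ⟩
  y                                          ∎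
  where open ≡-Reasoning

pair-injective : ∀ {x y x' y'} → pair x y ≡ pair x' y' → x ≡ x' × y ≡ y'
pair-injective {x} {y} {x'} {y'} eq = +-cancelʳ-≡ y x x' x+y≡x'+y , y≡y'
  where
  y≡y' : y ≡ y'
  y≡y' = trans (sym (unpair₂-pair x y)) (trans (cong unpair₂ eq) (unpair₂-pair x' y'))
  x+y≡x'+y : x + y ≡ x' + y
  x+y≡x'+y = trans (sym (diagonal-pair x y)) (trans (cong diagonal eq)
               (trans (diagonal-pair x' y') (cong (x' +_) (sym y≡y'))))

y≤pair : ∀ x y → y ≤ pair x y
y≤pair x y rewrite pair≡triangle+ x y = m≤n+m y _

Computes₁ : Code 1 → (ℕ → ℕ) → Set
Computes₁ c f = ∀ x → Eval c (x ∷ []) (f x)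

Computes₂ : Code 2 → (ℕ → ℕ → ℕ) → Set
Computes₂ c f = ∀ x y → Eval c (x ∷ y ∷ []) (f x y)

π₀ : ∀ {k} → Code (suc k)
π₀ = pr zero

π₁ : ∀ {k} → Code (suc (suc k))
π₁ = pr (suc zero)

infixr 9 _∘₁_
_∘₁_ : ∀ {k} → Code 1 → Code k → Code k
f ∘₁ g = comp f (g ∷ [])

eval-∘₁ : ∀ {k} {f g} {xs : Vec ℕ k} {y z} → Eval g xs y → Eval f (y ∷ []) z → Eval (f ∘₁ g) xs z
eval-∘₁ eval-g eval-f = ev-comp (ea-∷ eval-g ea-[]) eval-f

eval-comp₂ : ∀ {k} {f g h} {xs : Vec ℕ k} {y y' z} →
             Eval g xs y → Eval h xs y' → Eval f (y ∷ y' ∷ []) z → Eval (comp f (g ∷ h ∷ [])) xs z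
eval-comp₂ eval-g eval-h eval-f = ev-comp (ea-∷ eval-g (ea-∷ eval-h ea-[])) eval-f

eval-π₀ : ∀ {k} x (xs : Vec ℕ k) → Eval π₀ (x ∷ xs) x
eval-π₀ x xs = ev-pr zero (x ∷ xs)

eval-π₁ : ∀ {k} x y (xs : Vec ℕ k) → Eval π₁ (x ∷ y ∷ xs) y
eval-π₁ x y xs = ev-pr (suc zero) (x ∷ y ∷ xs)

twoCode : Code 1
twoCode = sc ∘₁ sc ∘₁ comp zr []

twoCode-computes : Computes₁ twoCode (λ _ → 2)
twoCode-computes x = eval-∘₁ (eval-∘₁ (ev-comp ea-[] ev-zr) (ev-sc 0)) (ev-sc 1)

addCode : Code 2
addCode = prec π₀ (sc ∘₁ π₁)

addCode-computes : Computes₂ addCode _+_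
addCode-computes zero    y = ev-prec0 (eval-π₀ y [])
addCode-computes (suc x) y =
  ev-precS (addCode-computes x y) (eval-∘₁ (eval-π₁ x (x + y) (y ∷ [])) (ev-sc (x + y)))

triangleCode : Code 1
triangleCode = prec zr (comp addCode (sc ∘₁ π₀ ∷ π₁ ∷ []))

triangleCode-computes : Computes₁ triangleCode triangle
triangleCode-computes zero    = ev-prec0 ev-zr
triangleCode-computes (suc s) = ev-precS (triangleCode-computes s)
  (eval-comp₂ (eval-∘₁ (eval-π₀ s _) (ev-sc s)) (eval-π₁ s _ []) (addCode-computes (suc s) (triangle s)))

predCode : Code 1
predCode = prec zr π₀

predCode-computes : Computes₁ predCode pred
predCode-computes zero    = ev-prec0 ev-zr
predCode-computes (suc n) = ev-precS (predCode-computes n) (eval-π₀ n _)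

monusCode : Code 2
monusCode = prec π₀ (predCode ∘₁ π₁)

monusCode-computes : Computes₂ monusCode (λ y x → x ∸ y)
monusCode-computes zero    x = ev-prec0 (eval-π₀ x [])
monusCode-computes (suc y) x = subst (Eval monusCode (suc y ∷ x ∷ [])) (pred[m∸n]≡m∸[1+n] x y)
  (ev-precS (monusCode-computes y x) (eval-∘₁ (eval-π₁ y (x ∸ y) _) (predCode-computes (x ∸ y))))

-- μ s. (1 + p) ∸ triangle (1 + s) ≡ 0, the least s with p < triangle (1 + s).
diagonalCode : Code 1
diagonalCode = mu (comp monusCode (triangleCode ∘₁ sc ∘₁ π₀ ∷ sc ∘₁ π₁ ∷ []))

diagonalCode-computes : Computes₁ diagonalCode diagonal
diagonalCode-computes p = ev-mu
  (subst (Eval body (diagonal p ∷ p ∷ [])) (m≤n⇒m∸n≡0 (proj₂ (diagonal-onDiagonal p)))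
         (eval-body (diagonal p)))
  λ s s<diagonal → p ∸ triangle (suc s) ,
    subst (Eval body (s ∷ p ∷ [])) (+-∸-assoc 1 (below s s<diagonal)) (eval-body s)
  where
  body : Code 2
  body = comp monusCode (triangleCode ∘₁ sc ∘₁ π₀ ∷ sc ∘₁ π₁ ∷ [])
  eval-body : ∀ s → Eval body (s ∷ p ∷ []) (suc p ∸ triangle (suc s))
  eval-body s = eval-comp₂ (eval-∘₁ (eval-∘₁ (eval-π₀ s _) (ev-sc s)) (triangleCode-computes (suc s)))
                           (eval-∘₁ (eval-π₁ s p []) (ev-sc p))
                           (monusCode-computes (triangle (suc s)) (suc p))
  below : ∀ s → s < diagonal p → triangle (suc s) ≤ p
  below s s<diagonal = ≤-trans (triangle-suc-≤ s<diagonal) (proj₁ (diagonal-onDiagonal p))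

unpair₂Code : Code 1
unpair₂Code = comp monusCode (triangleCode ∘₁ diagonalCode ∷ π₀ ∷ [])

unpair₂Code-computes : Computes₁ unpair₂Code unpair₂
unpair₂Code-computes p = eval-comp₂ (eval-∘₁ (diagonalCode-computes p) (triangleCode-computes (diagonal p)))
                                    (eval-π₀ p []) (monusCode-computes _ p)

ifZero : ℕ → ℕ → ℕ → ℕ
ifZero zero    a b = a
ifZero (suc _) a b = b

ifZeroCode : Code 3
ifZeroCode = prec π₀ (pr (suc (suc (suc zero))))

ifZeroCode-computes : ∀ n a b → Eval ifZeroCode (n ∷ a ∷ b ∷ []) (ifZero n a b)
ifZeroCode-computes zero    a b = ev-prec0 (eval-π₀ a _)
ifZeroCode-computes (suc n) a b =
  ev-precS (ifZeroCode-computes n a b) (ev-pr (suc (suc (suc zero))) _)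

foldCode : Code 1 → Code 2
foldCode c = prec π₀ (c ∘₁ π₁)

foldCode-computes : ∀ {c f} → Computes₁ c f → Computes₂ (foldCode c) (λ n x → fold x f n)
foldCode-computes c-computes zero    x = ev-prec0 (eval-π₀ x [])
foldCode-computes {f = f} c-computes (suc n) x = ev-precS (foldCode-computes c-computes n x)
  (eval-∘₁ (eval-π₁ n (fold x f n) _) (c-computes (fold x f n)))

previousBit : List Bool → Bool
previousBit w = fromMaybe false (last w)

previousBit-∷ʳ : ∀ w b → previousBit (w ++ [ b ]) ≡ b
previousBit-∷ʳ []          b = refl
previousBit-∷ʳ (a ∷ [])    b = refl
previousBit-∷ʳ (a ∷ c ∷ w) b = previousBit-∷ʳ (c ∷ w) b

-- On codes of nonempty lists: the codes 1 and 2 of the one-element lists are fixed,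
-- every longer list loses its head.
dropHead : ℕ → ℕ
dropHead x = ifZero (x ∸ 2) x (unpair₂ (pred x))

dropHeadCode : Code 1
dropHeadCode = comp ifZeroCode (comp monusCode (twoCode ∷ π₀ ∷ []) ∷ π₀ ∷ unpair₂Code ∘₁ predCode ∷ [])

dropHeadCode-computes : Computes₁ dropHeadCode dropHead
dropHeadCode-computes x = ev-comp
  (ea-∷ (eval-comp₂ (twoCode-computes x) (eval-π₀ x []) (monusCode-computes 2 x))
  (ea-∷ (eval-π₀ x [])
  (ea-∷ (eval-∘₁ (predCode-computes x) (unpair₂Code-computes (pred x))) ea-[])))
  (ifZeroCode-computes (x ∸ 2) x (unpair₂ (pred x)))

2≤pair-suc : ∀ x y → 2 ≤ pair x (suc y)
2≤pair-suc x y rewrite pair≡triangle+ x (suc y) | +-suc x y = +-mono-≤ (s≤s z≤n) (s≤s z≤n)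

dropHead-∷ : ∀ a b r → dropHead (encList bit (a ∷ b ∷ r)) ≡ encList bit (b ∷ r)
dropHead-∷ a b r with pair (bit a) (encList bit (b ∷ r)) ∸ 1
                    | m<n⇒0<n∸m {1} (2≤pair-suc (bit a) (pair (bit b) (encList bit r)))
... | suc _ | _ = unpair₂-pair (bit a) (encList bit (b ∷ r))

iterate-fixed : ∀ {f : ℕ → ℕ} {x} → f x ≡ x → ∀ n → iterate f x n ≡ x
iterate-fixed fx≡x zero    = refl
iterate-fixed fx≡x (suc n) rewrite fx≡x = iterate-fixed fx≡x n

iterate-dropHead : ∀ a r n → length r ≤ n →
                   iterate dropHead (encList bit (a ∷ r)) n ≡ suc (bit (previousBit (a ∷ r)))
iterate-dropHead true  []      n       _         = iterate-fixed refl n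
iterate-dropHead false []      n       _         = iterate-fixed refl n
iterate-dropHead a     (b ∷ r) (suc n) (s≤s r≤n) rewrite dropHead-∷ a b r = iterate-dropHead b r n r≤n

length≤encList : ∀ {A : Set} (e : A → ℕ) w → length w ≤ encList e w
length≤encList e []      = z≤n
length≤encList e (a ∷ w) = s≤s (≤-trans (length≤encList e w) (y≤pair (e a) (encList e w)))

previousBitCode : Code 1
previousBitCode = predCode ∘₁ comp (foldCode dropHeadCode) (π₀ ∷ π₀ ∷ [])

previousBit-computable : IsComputableStrategy previousBit
previousBit-computable = previousBitCode , eval
  where
  eval-fold : ∀ x → Eval previousBitCode (x ∷ []) (pred (fold x dropHead x))
  eval-fold x = eval-∘₁ (eval-comp₂ (eval-π₀ x []) (eval-π₀ x []) (foldCode-computes dropHeadCode-computes x x))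
                        (predCode-computes (fold x dropHead x))
  eval : ∀ w → Eval previousBitCode (encList bit w ∷ []) (bit (previousBit w))
  eval []      = eval-fold 0
  eval (a ∷ r) = subst (Eval previousBitCode (x ∷ [])) (cong pred iterated) (eval-fold x)
    where
    x = encList bit (a ∷ r)
    iterated : fold x dropHead x ≡ suc (bit (previousBit (a ∷ r)))
    iterated = trans (iterate-is-fold x dropHead x)
                     (iterate-dropHead a r x (≤-trans (n≤1+n _) (length≤encList bit (a ∷ r))))

Eval-functional : ∀ {k} {c : Code k} {xs z z'} → Eval c xs z → Eval c xs z' → z ≡ z'
EvalAll-functional : ∀ {k m} {cs : Vec (Code k) m} {xs ys ys'} →
                     EvalAll cs xs ys → EvalAll cs xs ys' → ys ≡ ys'
Eval-functional ev-zr          ev-zr            = refl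
Eval-functional (ev-sc x)      (ev-sc .x)       = refl
Eval-functional (ev-pr i xs)   (ev-pr .i .xs)   = refl
Eval-functional (ev-comp as f) (ev-comp as' f') with EvalAll-functional as as'
... | refl = Eval-functional f f'
Eval-functional (ev-prec0 g)   (ev-prec0 g')    = Eval-functional g g'
Eval-functional (ev-precS r h) (ev-precS r' h') with Eval-functional r r'
... | refl = Eval-functional h h'
Eval-functional (ev-mu {n = n} zero-at-n below-n) (ev-mu {n = n'} zero-at-n' below-n') with <-cmp n n'
... | tri≈ _ n≡n' _ = n≡n'
... | tri< n<n' _ _ with () ← Eval-functional zero-at-n (proj₂ (below-n' n n<n'))
... | tri> _ _ n'<n with () ← Eval-functional zero-at-n' (proj₂ (below-n n' n'<n))
EvalAll-functional ea-[]        ea-[]          = refl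
EvalAll-functional (ea-∷ e es) (ea-∷ e' es') =
  cong₂ _∷_ (Eval-functional e e') (EvalAll-functional es es')

tag : ∀ {k} → Code k → ℕ
tag zr         = 0
tag sc         = 1
tag (pr _)     = 2
tag (comp _ _) = 3
tag (prec _ _) = 4
tag (mu _)     = 5

encode    : ∀ {k} → Code k → ℕ
encodeAll : ∀ {k m} → Vec (Code k) m → ℕ
payload   : ∀ {k} → Code k → ℕ
encode c = pair (tag c) (payload c)
encodeAll []       = 0
encodeAll (c ∷ cs) = suc (pair (encode c) (encodeAll cs))
payload zr                    = 0
payload sc                    = 0
payload (pr i)                = toℕ i
payload (comp {m = m} f gs)   = pair m (pair (encode f) (encodeAll gs))
payload (prec g h)            = pair (encode g) (encode h)
payload (mu f)                = encode f

encode-injective    : ∀ {k} {c c' : Code k} → encode c ≡ encode c' → c ≡ c'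
encodeAll-injective : ∀ {k m} {cs cs' : Vec (Code k) m} → encodeAll cs ≡ encodeAll cs' → cs ≡ cs'
payload-injective   : ∀ {k} (c c' : Code k) → tag c ≡ tag c' → payload c ≡ payload c' → c ≡ c'
encode-injective {c = c} {c'} eq with pair-injective {tag c} {payload c} {tag c'} {payload c'} eq
... | same-tag , same-payload = payload-injective c c' same-tag same-payload
encodeAll-injective {cs = []}     {[]}       eq = refl
encodeAll-injective {cs = c ∷ cs} {c' ∷ cs'} eq
  with pair-injective {encode c} {encodeAll cs} {encode c'} {encodeAll cs'} (suc-injective eq)
... | c≡c' , cs≡cs' = cong₂ _∷_ (encode-injective c≡c') (encodeAll-injective cs≡cs')
-- The clauses for codes with different tags are absurd and left to the coverage checker.
payload-injective zr         zr           refl eq = refl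
payload-injective sc         sc           refl eq = refl
payload-injective (pr i)     (pr i')      refl eq = cong pr (toℕ-injective eq)
payload-injective (comp {m = m} f gs) (comp {m = m'} f' gs') refl eq with pair-injective {m} {x' = m'} eq
... | refl , rest with pair-injective {encode f} {encodeAll gs} {encode f'} {encodeAll gs'} rest
... | f≡f' , gs≡gs' = cong₂ comp (encode-injective f≡f') (encodeAll-injective gs≡gs')
payload-injective (prec g h) (prec g' h') refl eq
  with pair-injective {encode g} {encode h} {encode g'} {encode h'} eq
... | g≡g' , h≡h' = cong₂ prec (encode-injective g≡g') (encode-injective h≡h')
payload-injective (mu f)     (mu f')      refl eq = cong mu (encode-injective eq)

stepwise-mono : ∀ {d : ℕ → ℕ} → (∀ n → d n ≤ d (suc n)) → ∀ {i j} → i ≤ j → d i ≤ d j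
stepwise-mono {d} step i≤j = go (≤⇒≤′ i≤j)
  where
  go : ∀ {i j} → i ≤′ j → d i ≤ d j
  go ≤′-refl          = ≤-refl
  go (≤′-step i≤′j)   = ≤-trans (go i≤′j) (step _)

count-mono : ∀ A {i j} → i ≤ j → count A i ≤ count A j
count-mono A = stepwise-mono (λ n → m≤m+n (count A n) (bit (A n)))

count-cong-below : ∀ {A B : Set⊆ω} x → (∀ y → y < x → A y ≡ B y) → count A x ≡ count B x
count-cong-below zero    agree = refl
count-cong-below (suc x) agree =
  cong₂ _+_ (count-cong-below x (λ y y<x → agree y (m<n⇒m<1+n y<x))) (cong bit (agree x ≤-refl))

count-∘-increasing : ∀ A {d : ℕ → ℕ} → (∀ i → d i < d (suc i)) → ∀ n →
                     count (λ i → A (d i)) (suc n) ≤ count A (suc (d n))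
count-∘-increasing A {d} increasing zero = +-monoˡ-≤ (bit (A (d 0))) z≤n
count-∘-increasing A {d} increasing (suc n) = +-monoˡ-≤ (bit (A (d (suc n))))
  (≤-trans (count-∘-increasing A increasing n) (count-mono A (increasing n)))

bit-∨ : ∀ a b → bit (a ∨ b) ≤ bit a + bit b
bit-∨ true  b = s≤s z≤n
bit-∨ false b = ≤-refl

count-∨ : ∀ A B n → count (λ x → A x ∨ B x) n ≤ count A n + count B n
count-∨ A B zero    = z≤n
count-∨ A B (suc n) = begin
  count (λ x → A x ∨ B x) n + bit (A n ∨ B n)      ≤⟨ +-mono-≤ (count-∨ A B n) (bit-∨ (A n) (B n)) ⟩
  count A n + count B n + (bit (A n) + bit (B n))  ≡⟨ +-comm-middle (count A n) (count B n) _ _ ⟩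
  count A n + bit (A n) + (count B n + bit (B n))  ∎
  where
  open ≤-Reasoning
  +-comm-middle : ∀ a b c d → a + b + (c + d) ≡ a + c + (b + d)
  +-comm-middle = solve-∀

count-suc : ∀ A n → count A (suc n) ≡ bit (A 0) + count (λ x → A (suc x)) n
count-suc A zero    = sym (+-identityʳ (bit (A 0)))
count-suc A (suc n) = trans (cong (_+ bit (A (suc n))) (count-suc A n)) (+-assoc (bit (A 0)) _ _)

IsSkip-∷ʳ : ∀ σ p → IsSkip σ → Above (lastDoor σ) (proj₁ p) → IsSkip (σ ++ [ p ])
IsSkip-∷ʳ []          p _            _     = [-]
IsSkip-∷ʳ (q ∷ [])    p _            above = above ∷ [-]
IsSkip-∷ʳ (q ∷ r ∷ σ) p (q<r ∷ skip) above = q<r ∷ IsSkip-∷ʳ (r ∷ σ) p skip above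

lastDoor-∷ʳ : ∀ σ p → lastDoor (σ ++ [ p ]) ≡ just (proj₁ p)
lastDoor-∷ʳ []          p = refl
lastDoor-∷ʳ (q ∷ [])    p = refl
lastDoor-∷ʳ (q ∷ r ∷ σ) p = lastDoor-∷ʳ (r ∷ σ) p

IsSkipRule : (SkipSeq → ℕ) → Set
IsSkipRule f = ∀ σ → IsSkip σ → Above (lastDoor σ) (f σ)

door : (SkipSeq → ℕ) → Set⊆ω → ℕ → ℕ
door f A n = f (history f A n)

history-local : ∀ f {A B : Set⊆ω} {x} m → (∀ i → i < m → door f B i < x) →
                (∀ y → y < x → A y ≡ B y) → history f A m ≡ history f B m
history-local f zero    doors-below agree = refl
history-local f {A} {B} (suc m) doors-below agree
  rewrite history-local f m (λ i i<m → doors-below i (m<n⇒m<1+n i<m)) agree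
  = cong (λ b → history f B m ++ [ (door f B m , b) ]) (agree (door f B m) (doors-below m ≤-refl))

module _ {f} (f-rule : IsSkipRule f) where

  history-isSkip : ∀ A n → IsSkip (history f A n)
  history-isSkip A zero    = []
  history-isSkip A (suc n) = IsSkip-∷ʳ _ _ (history-isSkip A n) (f-rule _ (history-isSkip A n))

  door-< : ∀ A n → door f A n < door f A (suc n)
  door-< A n = subst (λ d → Above d (door f A (suc n))) (lastDoor-∷ʳ (history f A n) _)
                     (f-rule _ (history-isSkip A (suc n)))

  door-mono : ∀ A {i j} → i ≤ j → door f A i ≤ door f A j
  door-mono A = stepwise-mono (λ n → <⇒≤ (door-< A n))

  history-agree : ∀ {g} → (∀ σ → IsSkip σ → g σ ≡ f σ) → ∀ A n → history g A n ≡ history f A n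
  history-agree agree A zero = refl
  history-agree agree A (suc n)
    rewrite history-agree agree A n | agree (history f A n) (history-isSkip A n) = refl

  door-agree : ∀ {g} → (∀ σ → IsSkip σ → g σ ≡ f σ) → ∀ A n → door g A n ≡ door f A n
  door-agree agree A n rewrite history-agree agree A n = agree _ (history-isSkip A n)

-- Every one after position 0 has exactly one neighbouring one, i.e. the ones come in isolated
-- adjacent pairs (a one at position 0 is unconstrained).
PairedWindow : Bool → Bool → Bool → Set
PairedWindow a b c = bit (a ∧ b) + bit (b ∧ c) ≡ bit b

Paired : Set⊆ω → Set
Paired A = ∀ i → PairedWindow (A i) (A (suc i)) (A (suc (suc i)))

shiftʳ : Set⊆ω → Set⊆ω
shiftʳ A zero    = false
shiftʳ A (suc n) = A n

shiftʳ-paired : ∀ {A} → A 0 ≡ false → Paired A → Paired (shiftʳ A)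
shiftʳ-paired A0≡false paired zero    rewrite A0≡false = refl
shiftʳ-paired A0≡false paired (suc i) = paired i

adjacentOnes : Set⊆ω → Set⊆ω
adjacentOnes A x = A x ∧ A (suc x)

paired-count : ∀ {A} → A 0 ≡ false → Paired A → ∀ m →
               count (adjacentOnes A) (suc m) * 2 ≡ count A (suc m) + bit (adjacentOnes A m)
paired-count {A} A0≡false paired zero rewrite A0≡false = refl
paired-count {A} A0≡false paired (suc m) = begin
  (P + p') * 2              ≡⟨ *-distribʳ-+ 2 P p' ⟩
  P * 2 + p' * 2            ≡⟨ cong (_+ p' * 2) (paired-count A0≡false paired m) ⟩
  O + p + p' * 2            ≡⟨ regroup O p p' ⟩
  O + (p + p') + p'         ≡⟨ cong (λ n → O + n + p') (paired m) ⟩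
  O + bit (A (suc m)) + p'  ∎
  where
  open ≡-Reasoning
  P  = count (adjacentOnes A) (suc m)
  O  = count A (suc m)
  p  = bit (adjacentOnes A m)
  p' = bit (adjacentOnes A (suc m))
  regroup : ∀ o x y → o + x + y * 2 ≡ o + (x + y) + y
  regroup = solve-∀

previousBit-prefix : ∀ A n → previousBit (prefix A n) ≡ shiftʳ A n
previousBit-prefix A zero    = refl
previousBit-prefix A (suc n) = previousBit-∷ʳ (prefix A n) (A n)

nSel-previousBit : ∀ A n → nSel previousBit A n ≡ count (shiftʳ A) n
nSel-previousBit A zero    = refl
nSel-previousBit A (suc n) =
  cong₂ _+_ (nSel-previousBit A n) (cong bit (previousBit-prefix A n))

nSelOnes-previousBit : ∀ A n → nSelOnes previousBit A n ≡ count (adjacentOnes (shiftʳ A)) n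
nSelOnes-previousBit A zero    = refl
nSelOnes-previousBit A (suc n) =
  cong₂ _+_ (nSelOnes-previousBit A n) (cong (λ b → bit (b ∧ A n)) (previousBit-prefix A n))

previousBit-selects-infinitely : ∀ {A} → (∀ N → ∃ λ p → N ≤ p × A p ≡ true) → SelInfinite previousBit A
previousBit-selects-infinitely {A} ones N with ones N
... | p , N≤p , Ap = suc p , m≤n⇒m≤1+n N≤p , trans (previousBit-prefix A (suc p)) Ap

previousBit-overselects : ∀ {A} → A 0 ≡ false → Paired A → ∀ p → A p ≡ true → A (suc p) ≡ true →
                          nSel previousBit A (2 + p) < nSelOnes previousBit A (2 + p) * 2
previousBit-overselects {A} A0≡false paired p Ap Ap+1 = begin-strict
  nSel previousBit A (2 + p)                     ≡⟨ nSel-previousBit A (2 + p) ⟩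
  count C (2 + p)                                <⟨ m<m+n _ (s≤s z≤n) ⟩
  count C (2 + p) + 1                            ≡⟨ cong (λ b → count C (2 + p) + bit b) (cong₂ _∧_ Ap Ap+1) ⟨
  count C (2 + p) + bit (adjacentOnes C (suc p)) ≡⟨ paired-count refl (shiftʳ-paired A0≡false paired) (suc p) ⟨
  count (adjacentOnes C) (2 + p) * 2             ≡⟨ cong (_* 2) (nSelOnes-previousBit A (2 + p)) ⟨
  nSelOnes previousBit A (2 + p) * 2             ∎
  where
  open ≤-Reasoning
  C = shiftʳ A

paired-not-churchStochastic : ∀ {A} → A 0 ≡ false → Paired A →
                              (∀ N → ∃ λ p → N ≤ p × A p ≡ true × A (suc p) ≡ true) →
                              ¬ ChurchStochastic0 A
paired-not-churchStochastic {A} A0≡false paired adjacent-ones stochastic =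
  let N , balanced        = stochastic previousBit previousBit-computable
                                       (previousBit-selects-infinitely ones) 1
      p , N≤p , Ap , Ap+1 = adjacent-ones N
  in <⇒≱ (previousBit-overselects A0≡false paired p Ap Ap+1)
         (balanced (2 + p) (≤-trans N≤p (m≤n+m p 2)))
  where
  ones : ∀ N → ∃ λ p → N ≤ p × A p ≡ true
  ones N = let p , N≤p , Ap , _ = adjacent-ones N in p , N≤p , Ap

block : ℕ → Set⊆ω
block zero    zero          = true
block zero    (suc zero)    = true
block zero    (suc (suc _)) = false
block (suc Q) zero          = false
block (suc Q) (suc x)       = block Q x

block-below : ∀ Q {x} → x < Q → block Q x ≡ false
block-below (suc Q) {zero}  _         = refl
block-below (suc Q) {suc x} (s≤s x<Q) = block-below Q x<Q

block-start : ∀ Q → block Q Q ≡ true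
block-start zero    = refl
block-start (suc Q) = block-start Q

block-next : ∀ Q → block Q (suc Q) ≡ true
block-next zero    = refl
block-next (suc Q) = block-next Q

block-ones : ∀ Q {x} → block Q x ≡ true → x ≤ suc Q
block-ones zero    {zero}        _  = z≤n
block-ones zero    {suc zero}    _  = ≤-refl
block-ones (suc Q) {suc x}       Bx = s≤s (block-ones Q Bx)

block-paired : ∀ Q → Paired (block Q)
block-paired zero          zero          = refl
block-paired zero          (suc zero)    = refl
block-paired zero          (suc (suc i)) = refl
block-paired (suc zero)    zero          = refl
block-paired (suc (suc zero)) zero       = refl
block-paired (suc (suc (suc Q))) zero    = refl
block-paired (suc Q)       (suc i)       = block-paired Q i

count-block : ∀ Q n → count (block Q) n ≤ 2
count-block zero    zero          = z≤n
count-block zero    (suc zero)    = s≤s z≤n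
count-block zero    (suc (suc n)) = ≤-reflexive (full n)
  where
  full : ∀ n → count (block 0) (2 + n) ≡ 2
  full zero    = refl
  full (suc n) = trans (+-identityʳ _) (full n)
count-block (suc Q) zero    = z≤n
count-block (suc Q) (suc n) = ≤-trans (≤-reflexive (count-suc (block (suc Q)) n)) (count-block Q n)

PairedWindow-cong : ∀ {a a' b b' c c'} → a ≡ a' → b ≡ b' → c ≡ c' →
                    PairedWindow a' b' c' → PairedWindow a b c
PairedWindow-cong refl refl refl window = window

paired-∨-block : ∀ {B Q} → (∀ x → B x ≡ true → 2 + x < Q) → Paired B → Paired (λ x → B x ∨ block Q x)
paired-∨-block {B} {Q} separated paired i with 2 + i <? Q
... | yes i+2<Q = PairedWindow-cong (B-only i (≤-<-trans (m≤n+m i 2) i+2<Q))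
                                    (B-only (suc i) (≤-<-trans (n≤1+n (suc i)) i+2<Q))
                                    (B-only (suc (suc i)) i+2<Q) (paired i)
  where
  B-only : ∀ x → x < Q → B x ∨ block Q x ≡ B x
  B-only x x<Q = trans (cong (B x ∨_) (block-below Q x<Q)) (∨-identityʳ (B x))
... | no i+2≮Q = PairedWindow-cong (block-only i ≤-refl) (block-only (suc i) (n≤1+n i))
                                   (block-only (suc (suc i)) (m≤n+m i 2)) (block-paired Q i)
  where
  block-only : ∀ x → i ≤ x → B x ∨ block Q x ≡ block Q x
  block-only x i≤x =
    cong (_∨ block Q x) (¬-not λ Bx → i+2≮Q (≤-<-trans (+-monoʳ-≤ 2 i≤x) (separated x Bx)))

-- Once stage k protects them, the first horizon k selections of each rule e < k contain at most
-- 2 k ones, a density below 1 / (k + 1).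
horizon : ℕ → ℕ
horizon k = suc k * 2 * suc k

≤-max-applyUpTo : ∀ (h : ℕ → ℕ) {e k} → e < k → h e ≤ max 0 (applyUpTo h k)
≤-max-applyUpTo h e<k = All.lookup (xs≤max 0 (applyUpTo h _)) (∈-applyUpTo⁺ h e<k)

witnessOr : ∀ {A : Set} {P : A → Set} → A → Dec (∃ P) → A
witnessOr _ (yes (a , _)) = a
witnessOr a (no _)        = a

witnessOr-unique : ∀ {A : Set} {P : A → Set} {a} default (d : Dec (∃ P)) →
                   (∀ {b b'} → P b → P b' → b ≡ b') → P a → witnessOr default d ≡ a
witnessOr-unique _ (yes (b , pb)) unique pa = unique pb pa
witnessOr-unique _ (no none)      unique pa = ⊥-elim (none (_ , pa))

module Universal (em : ExcludedMiddle 0ℓ) where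

  decode : ℕ → Code 1
  decode n = witnessOr sc (em {P = ∃ λ c → encode c ≡ n})

  decode-encode : ∀ c → decode (encode c) ≡ c
  decode-encode c = witnessOr-unique sc em (λ eq eq' → encode-injective (trans eq (sym eq'))) refl

  run : Code 1 → ℕ → ℕ
  run c x = witnessOr 0 (em {P = ∃ λ z → Eval c (x ∷ []) z})

  run-eval : ∀ {c x z} → Eval c (x ∷ []) z → run c x ≡ z
  run-eval = witnessOr-unique 0 em Eval-functional

  rule : ℕ → SkipSeq → ℕ
  rule e σ = run (decode e) (encSkip σ)

  rule-universal : ∀ {f} → IsComputableSkipRule f → ∃ λ e → ∀ σ → IsSkip σ → rule e σ ≡ f σ
  rule-universal (_ , c , c-computes) = encode c , λ σ σ-skip →
    trans (cong (λ c → run c (encSkip σ)) (decode-encode c)) (run-eval (c-computes σ σ-skip))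

module Construction (em : ExcludedMiddle 0ℓ) where

  open Universal em

  approx     : ℕ → Set⊆ω
  bound      : ℕ → ℕ
  blockStart : ℕ → ℕ
  approx zero    x = false
  approx (suc k) x = approx k x ∨ block (blockStart k) x
  bound zero    = 0
  bound (suc k) = 2 + blockStart k
  blockStart k = 2 + bound k + max 0 (applyUpTo (λ e → door (rule e) (approx k) (horizon k)) k)

  A : Set⊆ω
  A x = approx (suc x) x

  2+bound≤blockStart : ∀ k → 2 + bound k ≤ blockStart k
  2+bound≤blockStart k = m≤m+n (2 + bound k) _

  door-<-blockStart : ∀ {e k} → e < k → door (rule e) (approx k) (horizon k) < blockStart k
  door-<-blockStart {e} {k} e<k = s≤s (m≤n⇒m≤1+n (≤-trans
    (≤-max-applyUpTo (λ e → door (rule e) (approx k) (horizon k)) e<k) (m≤n+m _ (bound k))))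

  bound-step : ∀ k → 4 + bound k ≤ bound (suc k)
  bound-step k = +-monoʳ-≤ 2 (2+bound≤blockStart k)

  bound-mono : ∀ {k k'} → k ≤ k' → bound k ≤ bound k'
  bound-mono = stepwise-mono (λ k → ≤-trans (m≤n+m (bound k) 4) (bound-step k))

  ≤-bound : ∀ k → k ≤ bound k
  ≤-bound zero    = z≤n
  ≤-bound (suc k) = ≤-trans (s≤s (≤-bound k)) (≤-trans (m≤n+m _ 3) (bound-step k))

  <-blockStart : ∀ k → k < blockStart k
  <-blockStart k = <-≤-trans (s≤s (m≤n⇒m≤1+n (≤-bound k))) (2+bound≤blockStart k)

  approx-ones : ∀ k {x} → approx k x ≡ true → x < bound k
  approx-ones (suc k) {x} approx-x with approx k x in eq
  ... | true  = ≤-trans (approx-ones k eq) (≤-trans (m≤n+m (bound k) 4) (bound-step k))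
  ... | false = s≤s (block-ones (blockStart k) approx-x)

  approx-step-below : ∀ k {x} → x < blockStart k → approx (suc k) x ≡ approx k x
  approx-step-below k {x} x<start =
    trans (cong (approx k x ∨_) (block-below (blockStart k) x<start)) (∨-identityʳ (approx k x))

  approx-stable : ∀ {k k' x} → k ≤ k' → x < bound k → approx k' x ≡ approx k x
  approx-stable {k} {x = x} k≤k' x<bound = go (≤⇒≤′ k≤k')
    where
    go : ∀ {k'} → k ≤′ k' → approx k' x ≡ approx k x
    go ≤′-refl = refl
    go (≤′-step {k'} k≤′k') = trans
      (approx-step-below k' (<-≤-trans x<bound (≤-trans (bound-mono (≤′⇒≤ k≤′k')) bound≤blockStart)))
      (go k≤′k')
      where
      bound≤blockStart : bound k' ≤ blockStart k'
      bound≤blockStart = ≤-trans (m≤n+m (bound k') 2) (2+bound≤blockStart k')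

  A-agrees : ∀ k {x} → x < bound k → A x ≡ approx k x
  A-agrees k {x} x<bound with ≤-total k (suc x)
  ... | inj₁ k≤1+x = approx-stable k≤1+x x<bound
  ... | inj₂ 1+x≤k = sym (approx-stable 1+x≤k (≤-bound (suc x)))

  A-agrees-below-blockStart : ∀ k {x} → x < blockStart k → A x ≡ approx k x
  A-agrees-below-blockStart k x<start =
    trans (A-agrees (suc k) (<-≤-trans x<start (m≤n+m (blockStart k) 2))) (approx-step-below k x<start)

  approx-paired : ∀ k → Paired (approx k)
  approx-paired zero    i = refl
  approx-paired (suc k) = paired-∨-block
    (λ x approx-x → <-≤-trans (+-monoʳ-< 2 (approx-ones k approx-x)) (2+bound≤blockStart k))
    (approx-paired k)

  A-paired : Paired A
  A-paired i = PairedWindow-cong (A-agrees k (<-trans (n<1+n i) (<-trans (n<1+n (suc i)) i+2<bound)))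
                                 (A-agrees k (<-trans (n<1+n (suc i)) i+2<bound))
                                 (A-agrees k i+2<bound) (approx-paired k i)
    where
    k = 3 + i
    i+2<bound : 2 + i < bound k
    i+2<bound = ≤-bound k

  A-zero : A 0 ≡ false
  A-zero = refl

  A-block : ∀ k {x} → block (blockStart k) x ≡ true → A x ≡ true
  A-block k {x} in-block = begin
    A x                                   ≡⟨ A-agrees (suc k) (s≤s (block-ones (blockStart k) in-block)) ⟩
    approx k x ∨ block (blockStart k) x   ≡⟨ cong (approx k x ∨_) in-block ⟩
    approx k x ∨ true                     ≡⟨ ∨-zeroʳ (approx k x) ⟩
    true                                  ∎
    where open ≡-Reasoning

  A-adjacent-ones : ∀ N → ∃ λ p → N ≤ p × A p ≡ true × A (suc p) ≡ true
  A-adjacent-ones N = Q , <⇒≤ (<-blockStart N) , A-block N {Q} (block-start Q) , A-block N {suc Q} (block-next Q)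
    where Q = blockStart N

  count-approx : ∀ k n → count (approx k) n ≤ k * 2
  count-approx zero    zero    = z≤n
  count-approx zero    (suc n) = ≤-trans (≤-reflexive (+-identityʳ _)) (count-approx zero n)
  count-approx (suc k) n = ≤-trans (count-∨ (approx k) (block (blockStart k)) n)
    (≤-trans (+-mono-≤ (count-approx k n) (count-block (blockStart k) n))
             (≤-reflexive (+-comm (k * 2) 2)))

  count-A : ∀ k {y} → y ≤ blockStart k → count A y ≤ k * 2
  count-A k {y} y≤start = ≤-trans
    (≤-reflexive (count-cong-below y (λ x x<y → A-agrees-below-blockStart k (<-≤-trans x<y y≤start))))
    (count-approx k y)

  module _ {f} (f-rule : IsSkipRule f) {e} (agree : ∀ σ → IsSkip σ → rule e σ ≡ f σ) where

    door-horizon : ∀ {j} → e < j → door f A (horizon j) < blockStart j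
    door-horizon {j} e<j = subst (_< blockStart j) (cong f (sym same-history)) doors-below
      where
      doors-below : door f (approx j) (horizon j) < blockStart j
      doors-below = subst (_< blockStart j) (door-agree f-rule agree (approx j) (horizon j))
                          (door-<-blockStart e<j)
      same-history : history f A (horizon j) ≡ history f (approx j) (horizon j)
      same-history = history-local f (horizon j)
        (λ i i<horizon → ≤-<-trans (door-mono f-rule (approx j) (<⇒≤ i<horizon)) doors-below)
        (λ y y<start → A-agrees-below-blockStart j y<start)

    late-door : ∀ {j n} → e < j → blockStart j ≤ door f A n → horizon j < n
    late-door {j} {n} e<j start≤door = ≰⇒> λ n≤horizon →
      <-irrefl refl (<-≤-trans (door-horizon e<j) (≤-trans start≤door (door-mono f-rule A n≤horizon)))

    count-selected : ∀ k n → door f A n < blockStart k → count (selected f A) (suc n) ≤ k * 2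
    count-selected k n door<start =
      ≤-trans (count-∘-increasing A (door-< f-rule A) n) (count-A k door<start)

    module _ (K : ℕ) where

      R N : ℕ
      R = K + suc e
      N = R * 2 * suc K

      Dense : ℕ → Set
      Dense n = count (selected f A) (suc n) * suc K ≤ suc n

      dense-early : ∀ k n → N ≤ suc n → door f A n < blockStart k → k ≤ R → Dense n
      dense-early k n N≤n door<start k≤R =
        ≤-trans (*-monoˡ-≤ (suc K) (≤-trans (count-selected k n door<start) (*-monoˡ-≤ 2 k≤R))) N≤n

      dense-late : ∀ j n → R ≤ j → door f A n < blockStart (suc j) → blockStart j ≤ door f A n → Dense n
      dense-late j n R≤j door<start start≤door = begin
        count (selected f A) (suc n) * suc K  ≤⟨ *-monoˡ-≤ (suc K) (count-selected (suc j) n door<start) ⟩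
        suc j * 2 * suc K                     ≤⟨ *-monoʳ-≤ (suc j * 2) (s≤s K≤j) ⟩
        horizon j                             <⟨ late-door e<j start≤door ⟩
        n                                     <⟨ n<1+n n ⟩
        suc n                                 ∎
        where
        open ≤-Reasoning
        K≤j : K ≤ j
        K≤j = ≤-trans (m≤m+n K (suc e)) R≤j
        e<j : e < j
        e<j = <-≤-trans (n<1+n e) (≤-trans (m≤n+m (suc e) K) R≤j)

      -- Descend to the first stage whose block lies beyond the n-th door.
      dense : ∀ k n → N ≤ suc n → door f A n < blockStart k → Dense n
      dense zero    n N≤n door<start = dense-early zero n N≤n door<start z≤n
      dense (suc j) n N≤n door<start =
        [ dense-early (suc j) n N≤n door<start
        , (λ R<1+j → [ dense j n N≤n
                     , dense-late j n (≤-pred R<1+j) door<start ]′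
                     (<-≤-connex (door f A n) (blockStart j))) ]′
        (≤-<-connex (suc j) R)

    selected-density0 : Density0 (selected f A)
    selected-density0 K = N K , λ where
      zero    _   → z≤n
      (suc n) N≤n → dense K (door f A n) n N≤n (<-blockStart (door f A n))

  weaklyStochastic : WeaklyStochastic0 A
  weaklyStochastic f f-computable =
    let e , agree = rule-universal f-computable in selected-density0 (proj₁ f-computable) agree

theorem2 : ExcludedMiddle 0ℓ →
    Σ Set⊆ω (λ A → WeaklyStochastic0 A × ¬ ChurchStochastic0 A)
theorem2 em = A , weaklyStochastic , paired-not-churchStochastic A-zero A-paired A-adjacent-ones
  where open Construction em
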